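{- Let $G$ be a graph of genus $g$ and let $\mathfrak{C}$ be a cycle orientation configuration of $G$. The following are equivalent: (i) $\mathfrak{C}$ is geometric; (ii) there exists a spanning tree $T$ of $G$, with $e_1,\ldots,e_g$ the edges not in $T$, and real weights $\alpha_1,\ldots,\alpha_g$ such that for every cycle $C$ of $G$, oriented as in $\mathfrak{C}$, $\sum_{e_i\in C}\operatorname{sign}(C,e_i)\alpha_i>0$; (iii) for every spanning tree $T$ of $G$, with $e_1,\ldots,e_g$ the edges not in $T$, there exist such weights $\alpha_1,\ldots,\alpha_g$.
   Context: Graphs are finite and connected, possibly with parallel edges but without loops; cycles are simple cycles; $g=|E|-|V|+1$. Each edge has a fixed reference orientation. For an oriented cycle $C$ and edge $e\in C$, $\operatorname{sign}(C,e)=1$ if $e$ is traversed by $C$ in its reference direction and $-1$ otherwise; $C$ is identified with $\sum_{e\in C}\operatorname{sign}(C,e)e\in C_1(G,\mathbb{R})$, the real vector space with orthonormal basis $E(G)$. $H_1(G,\mathbb{R})\subset C_1(G,\mathbb{R})$ is the span of all cycles. A cycle orientation configuration is an assignment of an orientation to each cycle of $G$. It is called geometric if there exists $\mathbf{w}\in H_1(G,\mathbb{R})$ with $\langle\mathbf{w},C\rangle>0$ for every cycle $C$ oriented as in the configuration (equivalently, it arises from shifting the polyhedral decomposition of the tropical Jacobian along a generic vector $\mathbf{w}$). -}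

module Defs where

open import Level using (0ℓ)
open import Data.Nat using (ℕ)
open import Data.Integer as ℤ using (ℤ; +_; -[1+_])
open import Data.Fin using (Fin)
open import Data.Fin.Properties using () renaming (_≟_ to _≟ᶠ_)
open import Data.Bool using (Bool; true; false; T; not)
open import Data.List using (List; []; _∷_; map; foldr; allFin)
open import Data.Bool using (if_then_else_)
import Data.Product
open import Data.List.Relation.Unary.All using (All)
open import Data.List.Relation.Unary.Unique.Propositional using (Unique)
open import Data.Product using (Σ; ∃; ∃-syntax; _×_; _,_)
open import Data.Sum using (_⊎_)
open import Data.Empty using (⊥)
open import Relation.Nullary using (¬_; yes; no)
open import Relation.Binary.PropositionalEquality using (_≡_; _≢_)
open import Relation.Binary.Structures using (IsStrictTotalOrder)
open import Algebra.Bundles using (CommutativeRing)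

-- The real numbers, axiomatised as a complete ordered field
-- (characterises ℝ up to isomorphism).

record RealField : Set₁ where
  field
    commRing : CommutativeRing 0ℓ 0ℓ
  open CommutativeRing commRing public
  field
    _<_                 : Carrier → Carrier → Set
    <-isStrictTotalOrder : IsStrictTotalOrder _≈_ _<_
    0≉1                 : ¬ (0# ≈ 1#)
    inverse             : ∀ x → ¬ (x ≈ 0#) → ∃[ y ] (x * y ≈ 1#)
    +-mono-<            : ∀ {x y} z → x < y → (x + z) < (y + z)
    *-pos               : ∀ {x y} → 0# < x → 0# < y → 0# < (x * y)
  _≤_ : Carrier → Carrier → Set
  x ≤ y = (x < y) ⊎ (x ≈ y)
  field
    sup : (P : Carrier → Set) → ∃[ x ] P x → ∃[ b ] (∀ x → P x → x ≤ b) →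
          ∃[ s ] ((∀ x → P x → x ≤ s) × (∀ b → (∀ x → P x → x ≤ b) → s ≤ b))

-- Finite connected graphs, parallel edges allowed, no loops.
-- Vertices Fin n, edges Fin m; edge e has reference orientation
-- src e → tgt e.

EdgeSet : ℕ → Set
EdgeSet m = Fin m → Bool

data Reach {n m : ℕ} (src tgt : Fin m → Fin n) (S : EdgeSet m) : Fin n → Fin n → Set where
  here : ∀ {x} → Reach src tgt S x x
  fwd  : ∀ {y} e → T (S e) → Reach src tgt S (tgt e) y → Reach src tgt S (src e) y
  bwd  : ∀ {y} e → T (S e) → Reach src tgt S (src e) y → Reach src tgt S (tgt e) y

record Graph : Set where
  field
    n m     : ℕ
    src tgt : Fin m → Fin n
    noLoop    : ∀ e → src e ≢ tgt e
    connected : ∀ x y → Reach src tgt (λ _ → true) x y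

module _ (G : Graph) where
  open Graph G

  -- a dart: an edge together with a traversal direction
  -- (true = reference direction, false = opposite)
  Dart : Set
  Dart = Fin m × Bool

  edge : Dart → Fin m
  edge (e , _) = e

  tailD headD : Dart → Fin n
  tailD (e , true)  = src e
  tailD (e , false) = tgt e
  headD (e , true)  = tgt e
  headD (e , false) = src e

  signD : Dart → ℤ
  signD (_ , true)  = + 1
  signD (_ , false) = -[1+ 0 ]

  Chain : Fin n → List Dart → Fin n → Set
  Chain x []       y = x ≡ y
  Chain x (d ∷ ds) y = (tailD d ≡ x) × Chain (headD d) ds y

  IsCycleWalk : List Dart → Set
  IsCycleWalk ds = (ds ≢ []) × (∃[ x ] Chain x ds x)
                   × Unique (map tailD ds) × Unique (map edge ds)

  -- the element Σ_{e∈C} sign(C,e) e of C₁(G,ℤ) ⊆ C₁(G,ℝ)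
  cycleVec : List Dart → Fin m → ℤ
  cycleVec []       e = + 0
  cycleVec (d ∷ ds) e with edge d ≟ᶠ e
  ... | yes _ = signD d ℤ.+ cycleVec ds e
  ... | no  _ = cycleVec ds e

  -- oriented cycles, identified with their vectors in C₁
  IsCycle : (Fin m → ℤ) → Set
  IsCycle v = ∃[ ds ] (IsCycleWalk ds × (∀ e → cycleVec ds e ≡ v e))

  negVec : (Fin m → ℤ) → Fin m → ℤ
  negVec v e = ℤ.- v e

  record CycleOrientationConfig : Set₁ where
    field
      chosen      : (Fin m → ℤ) → Set
      chosen-one  : ∀ v → IsCycle v → chosen v ⊎ chosen (negVec v)
      chosen-excl : ∀ v → IsCycle v → chosen v → chosen (negVec v) → ⊥

  IsSpanningTree : EdgeSet m → Set
  IsSpanningTree S = (∀ x y → Reach src tgt S x y)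
                   × (∀ ds → IsCycleWalk ds → All (λ d → T (S (edge d))) ds → ⊥)

  module _ (R : RealField) where
    open RealField R

    nmul : ℕ → Carrier → Carrier
    nmul ℕ.zero    x = 0#
    nmul (ℕ.suc k) x = x + nmul k x

    zmul : ℤ → Carrier → Carrier
    zmul (+ k)    x = nmul k x
    zmul -[1+ k ] x = - (nmul (ℕ.suc k) x)

    sumE : (Fin m → Carrier) → Carrier
    sumE f = foldr (λ e acc → f e + acc) 0# (allFin m)

    inner : (Fin m → Carrier) → (Fin m → ℤ) → Carrier
    inner w v = sumE (λ e → zmul (v e) (w e))

    -- H₁(G,ℝ): the real span of all cycles
    InH1 : (Fin m → Carrier) → Set
    InH1 w = Σ (List (Carrier × (Fin m → ℤ))) λ cs → (All (λ p → IsCycle (Data.Product.proj₂ p)) cs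
                      × (∀ e → w e ≈ foldr (λ p acc →
                              (Data.Product.proj₁ p * zmul (Data.Product.proj₂ p e) 1#) + acc) 0# cs))

    module _ (𝔠 : CycleOrientationConfig) where
      open CycleOrientationConfig 𝔠

      Geometric : Set
      Geometric = ∃[ w ] (InH1 w × (∀ v → IsCycle v → chosen v → 0# < inner w v))

      -- weights α attached to the non-tree edges of S (values of α on tree
      -- edges are ignored):  Σ_{eᵢ ∈ C, eᵢ ∉ T} sign(C,eᵢ) αᵢ > 0 for all chosen C
      GoodWeights : EdgeSet m → (Fin m → Carrier) → Set
      GoodWeights S α = ∀ v → IsCycle v → chosen v →
        0# < sumE (λ e → if S e then 0# else zmul (v e) (α e))

module Submission where

open import Defs
open import Data.Nat using (ℕ)
import Data.Nat as Nat
import Data.Nat.Properties as Natₚ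
open import Data.Nat.Induction using (<-wellFounded)
open import Induction.WellFounded using (Acc; acc)
open import Data.Integer as ℤ using (ℤ; +_; -[1+_])
import Data.Integer.Properties as ℤₚ
open import Data.Integer.Solver using (module +-*-Solver)
open import Data.Fin as Fin using (Fin)
open import Data.Fin.Subset using (Subset; ⁅_⁆; _∪_; ∣_∣) renaming (_∈_ to _∈ᵥ_; _∉_ to _∉ᵥ_)
open import Data.Fin.Subset.Properties using (_∈?_; x∈⁅x⁆; x∈⁅y⁆⇒x≡y; p⊆p∪q; q⊆p∪q; x∈p∪q⁻; ∣p∣≤n; ∣p∣≡n⇒p≡⊤; ∈⊤; p⊂q⇒∣p∣<∣q∣)
open import Data.Fin.Properties using (suc-injective) renaming (_≟_ to _≟ᶠ_; any? to anyFin?)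
open import Data.Bool using (true; false; T; if_then_else_)
open import Data.Bool.Properties using () renaming (_≟_ to _≟ᵇ_)
open import Data.List using (List; []; _∷_; _++_; map; length; foldr; tabulate; filter; allFin)
open import Data.List.Properties using (length-++; foldr-map)
open import Data.List.Relation.Unary.Unique.Propositional.Properties using (filter⁺; allFin⁺)
open import Data.List.Relation.Unary.Any using (here; there; any?)
import Data.List.Relation.Unary.Any.Properties as Any
open import Data.List.Relation.Unary.All as All using (All; []; _∷_)
open import Data.List.Relation.Unary.All.Properties using (++⁻; ++⁺; ¬Any⇒All¬)
import Data.List.Relation.Unary.All.Properties as All
open import Data.List.Relation.Unary.Unique.Propositional using (Unique)
open import Data.List.Relation.Unary.AllPairs using ([]; _∷_)
open import Data.List.Membership.Propositional using (_∈_; _∉_; find)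
open import Data.List.Membership.Propositional.Properties using (∈-∃++; ∈-map⁺; ∈-++⁺ˡ; ∈-++⁺ʳ; ∈-filter⁺; ∈-filter⁻; ∈-allFin)
open import Data.Product using (∃-syntax; _×_; _,_; proj₁; proj₂)
open import Data.Sum using (_⊎_; inj₁; inj₂)
open import Data.Empty using (⊥; ⊥-elim)
open import Relation.Nullary using (¬_; Dec; yes; no; does)
open import Relation.Nullary.Decidable using (_×-dec_; _⊎-dec_; ¬?)
open import Relation.Binary.Definitions using (DecidableEquality; tri<; tri≈; tri>)
open import Relation.Binary.Structures using (IsStrictTotalOrder)
open import Function using (_∘_)
open import Data.Maybe using (nothing)
import Tactic.RingSolver.Core.AlmostCommutativeRing as ACR
import Tactic.RingSolver.NonReflective as NonReflective
import Relation.Binary.PropositionalEquality as ≡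
open ≡ using (_≡_; _≢_)

-- (i ⇒ iii)  Let w be positive on chosen cycles and S a spanning tree with
-- root r.  Integrating w along tree walks from r gives a potential φ; since
-- closed walks inside an acyclic edge set have zero cycle vector, w agrees
-- with the gradient ∇φ on S.  So α = w − ∇φ vanishes on S, and ⟨w, C⟩ =
-- ⟨α, C⟩ is exactly the reduced sum of (iii), because ∇φ integrates to zero
-- around cycles.  (iii ⇒ ii) is the existence of a spanning tree, grown
-- greedily from a root.  (ii ⇒ i)  Choose w in the span of the fundamental
-- cycles C_e (e ∉ S) with ⟨w, C_e⟩ = α_e: this Gram system is solvable since
-- C_e has a pivot at e.  The weights w − ∇φ from (i ⇒ iii) then agree with α
-- off S, so w is positive on every chosen cycle.

module ListFacts where
  open Nat using (suc; _≤_; _<_; z≤n; s≤s)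
  open Natₚ using (≤-trans; m≤n+m; m≤m+n; n≤1+n; m≤n⇒m≤1+n; +-suc)
  open ≡ using (refl; sym; cong; subst)

  record Repetition {A B : Set} (f : A → B) (xs : List A) : Set where
    constructor repetition
    field
      P Q R : List A
      a b   : A
      split : xs ≡ P ++ a ∷ (Q ++ b ∷ R)
      same  : f a ≡ f b

  module _ {A B : Set} (f : A → B) (_≟_ : DecidableEquality B) where

    uniqueOrRepetition : ∀ xs → Unique (map f xs) ⊎ Repetition f xs
    uniqueOrRepetition [] = inj₁ []
    uniqueOrRepetition (x ∷ ys) with any? (λ y → f x ≟ f y) ys
    ... | yes hit with find hit
    ...   | b , b∈ys , same with ∈-∃++ b∈ys
    ...     | Q , R , refl = inj₂ (repetition [] Q R x b refl same)
    uniqueOrRepetition (x ∷ ys) | no miss with uniqueOrRepetition ys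
    ... | inj₁ u = inj₁ (All.map⁺ (¬Any⇒All¬ ys miss) ∷ u)
    ... | inj₂ (repetition P Q R a b refl same) = inj₂ (repetition (x ∷ P) Q R a b refl same)

  uniqueMap-injective : ∀ {A B : Set} (f : A → B) {xs} → Unique (map f xs) →
                        ∀ {a b} → a ∈ xs → b ∈ xs → f a ≡ f b → a ≡ b
  uniqueMap-injective f {x ∷ xs} (_ ∷ _)    (here refl) (here refl) _ = refl
  uniqueMap-injective f {x ∷ xs} (fx∉ ∷ _) (here refl) (there b∈) e =
    ⊥-elim (All.lookup fx∉ (∈-map⁺ f b∈) e)
  uniqueMap-injective f {x ∷ xs} (fx∉ ∷ _) (there a∈) (here refl) e =
    ⊥-elim (All.lookup fx∉ (∈-map⁺ f a∈) (sym e))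
  uniqueMap-injective f {x ∷ xs} (_ ∷ u)    (there a∈) (there b∈) e =
    uniqueMap-injective f u a∈ b∈ e

  module _ {A : Set} where
    length-suffix : ∀ (Q R : List A) → length R ≤ length (Q ++ R)
    length-suffix Q R rewrite length-++ Q {R} = m≤n+m (length R) (length Q)

    shorter-prefix : ∀ (P R : List A) a → length P < length (P ++ a ∷ R)
    shorter-prefix []      R a = s≤s z≤n
    shorter-prefix (x ∷ P) R a = s≤s (shorter-prefix P R a)

    shorter-cutLoop : ∀ (P Q R : List A) a b →
                      length (P ++ b ∷ R) < length (P ++ a ∷ (Q ++ b ∷ R))
    shorter-cutLoop []      Q R a b = s≤s (length-suffix Q (b ∷ R))
    shorter-cutLoop (x ∷ P) Q R a b = s≤s (shorter-cutLoop P Q R a b)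

    shorter-cutBoth : ∀ (P Q R : List A) a b →
                      length (P ++ R) < length (P ++ a ∷ (Q ++ b ∷ R))
    shorter-cutBoth []      Q R a b = s≤s (≤-trans (n≤1+n _) (length-suffix Q (b ∷ R)))
    shorter-cutBoth (x ∷ P) Q R a b = s≤s (shorter-cutBoth P Q R a b)

    shorter-loop : ∀ (P Q R : List A) a b → length (a ∷ Q) < length (P ++ a ∷ (Q ++ b ∷ R))
    shorter-loop []      Q R a b rewrite length-++ Q {b ∷ R} =
      s≤s (subst (suc (length Q) ≤_) (sym (+-suc (length Q) (length R)))
                 (s≤s (m≤m+n (length Q) (length R))))
    shorter-loop (x ∷ P) Q R a b = m≤n⇒m≤1+n (shorter-loop P Q R a b)

    shorter-inner : ∀ (P Q R : List A) a b → length Q < length (P ++ a ∷ (Q ++ b ∷ R))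
    shorter-inner P Q R a b = ≤-trans (n≤1+n _) (shorter-loop P Q R a b)

module Walks (G : Graph) where
  open Graph G
  open ListFacts
  open Nat using (_<_)
  open ≡ using (refl; sym; trans; cong; cong₂; subst)
  open ≡.≡-Reasoning

  tl hd : Dart G → Fin n
  tl = tailD G
  hd = headD G

  ed : Dart G → Fin m
  ed = edge G

  cv : List (Dart G) → Fin m → ℤ
  cv = cycleVec G

  InS : EdgeSet m → Dart G → Set
  InS S d = T (S (ed d))

  Acyclic : EdgeSet m → Set
  Acyclic S = ∀ ds → IsCycleWalk G ds → All (InS S) ds → ⊥

  Simple : List (Dart G) → Set
  Simple ds = Unique (map tl ds) × Unique (map ed ds)

  chain-++ : ∀ as {x y z bs} → Chain G x as y → Chain G y bs z → Chain G x (as ++ bs) z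
  chain-++ []       refl    c′ = c′
  chain-++ (d ∷ as) (t , c) c′ = t , chain-++ as c c′

  chain-split : ∀ as {x z bs} → Chain G x (as ++ bs) z → ∃[ y ] (Chain G x as y × Chain G y bs z)
  chain-split []       c = _ , refl , c
  chain-split (d ∷ as) (t , c) with chain-split as c
  ... | y , c₁ , c₂ = y , (t , c₁) , c₂

  cv-++ : ∀ as bs e → cv (as ++ bs) e ≡ cv as e ℤ.+ cv bs e
  cv-++ []       bs e = sym (ℤₚ.+-identityˡ _)
  cv-++ (d ∷ as) bs e with ed d ≟ᶠ e
  ... | yes _ = trans (cong (λ z → signD G d ℤ.+ z) (cv-++ as bs e)) (sym (ℤₚ.+-assoc (signD G d) _ _))
  ... | no  _ = cv-++ as bs e

  Reverse : Dart G → Dart G → Set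
  Reverse a b = (ed a ≡ ed b) × (proj₂ a ≢ proj₂ b)

  reverse-cancels : ∀ a b → Reverse a b → ∀ e → cv (a ∷ []) e ℤ.+ cv (b ∷ []) e ≡ + 0
  reverse-cancels (f , s) (.f , t) (refl , s≢t) e with f ≟ᶠ e
  reverse-cancels (f , false) (.f , false) (refl , s≢t) e | yes _ = ⊥-elim (s≢t refl)
  reverse-cancels (f , false) (.f , true)  (refl , s≢t) e | yes _ = refl
  reverse-cancels (f , true)  (.f , false) (refl , s≢t) e | yes _ = refl
  reverse-cancels (f , true)  (.f , true)  (refl , s≢t) e | yes _ = ⊥-elim (s≢t refl)
  ... | no _ = refl

  reverse-ends : ∀ a b → Reverse a b → (tl b ≡ hd a) × (hd b ≡ tl a)
  reverse-ends (f , false) (.f , false) (refl , s≢t) = ⊥-elim (s≢t refl)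
  reverse-ends (f , false) (.f , true)  (refl , s≢t) = refl , refl
  reverse-ends (f , true)  (.f , false) (refl , s≢t) = refl , refl
  reverse-ends (f , true)  (.f , true)  (refl , s≢t) = ⊥-elim (s≢t refl)

  data Shortcut (ds : List (Dart G)) : Set where
    revisit   : ∀ P Q R a b → ds ≡ P ++ a ∷ (Q ++ b ∷ R) → tl a ≡ tl b → Shortcut ds
    backtrack : ∀ P Q R a b → ds ≡ P ++ a ∷ (Q ++ b ∷ R) → Reverse a b → Shortcut ds

  -- Every walk is simple or has a shortcut.  (Traversing the same dart
  -- twice is a revisit of its tail.)
  simpleOrShortcut : ∀ ds → Simple ds ⊎ Shortcut ds
  simpleOrShortcut ds with uniqueOrRepetition tl _≟ᶠ_ ds
  ... | inj₂ (repetition P Q R a b eq same) = inj₂ (revisit P Q R a b eq same)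
  ... | inj₁ uT with uniqueOrRepetition ed _≟ᶠ_ ds
  ...   | inj₁ uE = inj₁ (uT , uE)
  ...   | inj₂ (repetition P Q R (f , s) (.f , t) eq refl) with s ≟ᵇ t
  ...     | yes refl = inj₂ (revisit P Q R (f , s) (f , s) eq refl)
  ...     | no s≢t   = inj₂ (backtrack P Q R (f , s) (f , t) eq (refl , s≢t))

  record Detour (Pr : Dart G → Set) (x y : Fin n) (ds : List (Dart G)) : Set where
    field
      outer loop    : List (Dart G)
      base          : Fin n
      outer-chain   : Chain G x outer y
      loop-chain    : Chain G base loop base
      outer-all     : All Pr outer
      loop-all      : All Pr loop
      outer-shorter : length outer < length ds
      loop-shorter  : length loop < length ds
      cv-split      : ∀ e → cv ds e ≡ cv outer e ℤ.+ cv loop e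

  module _ {Pr : Dart G → Set} {x y : Fin n} (P Q R : List (Dart G)) (a b : Dart G) where
    private
      ds : List (Dart G)
      ds = P ++ a ∷ (Q ++ b ∷ R)
      open +-*-Solver

      record Pieces : Set where
        field
          cP : Chain G x P (tl a)
          cQ : Chain G (hd a) Q (tl b)
          cR : Chain G (hd b) R y
          aP : All Pr P
          pa : Pr a
          aQ : All Pr Q
          pb : Pr b
          aR : All Pr R

      pieces : Chain G x ds y → All Pr ds → Pieces
      pieces c al with chain-split P c | ++⁻ P al
      ... | _ , c₁ , (t , c₂) | aP , (pa ∷ al′) with chain-split Q c₂ | ++⁻ Q al′
      ... | _ , c₃ , (t′ , c₄) | aQ , (pb ∷ aR) = record
        { cP = subst (Chain G x P) (sym t) c₁ ; cQ = subst (Chain G _ Q) (sym t′) c₃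
        ; cR = c₄ ; aP = aP ; pa = pa ; aQ = aQ ; pb = pb ; aR = aR }

      cv-pieces : ∀ e → cv ds e ≡ cv P e ℤ.+ (cv (a ∷ []) e ℤ.+ (cv Q e ℤ.+ (cv (b ∷ []) e ℤ.+ cv R e)))
      cv-pieces e = begin
        cv ds e
          ≡⟨ cv-++ P (a ∷ (Q ++ b ∷ R)) e ⟩
        cv P e ℤ.+ cv (a ∷ Q ++ b ∷ R) e
          ≡⟨ cong (λ z → cv P e ℤ.+ z) (cv-++ (a ∷ []) (Q ++ b ∷ R) e) ⟩
        cv P e ℤ.+ (cv (a ∷ []) e ℤ.+ cv (Q ++ b ∷ R) e)
          ≡⟨ cong (λ z → cv P e ℤ.+ (cv (a ∷ []) e ℤ.+ z)) (cv-++ Q (b ∷ R) e) ⟩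
        cv P e ℤ.+ (cv (a ∷ []) e ℤ.+ (cv Q e ℤ.+ cv (b ∷ R) e))
          ≡⟨ cong (λ z → cv P e ℤ.+ (cv (a ∷ []) e ℤ.+ (cv Q e ℤ.+ z))) (cv-++ (b ∷ []) R e) ⟩
        cv P e ℤ.+ (cv (a ∷ []) e ℤ.+ (cv Q e ℤ.+ (cv (b ∷ []) e ℤ.+ cv R e))) ∎

    revisitDetour : tl a ≡ tl b → Chain G x ds y → All Pr ds → Detour Pr x y ds
    revisitDetour same c al = record
      { outer = P ++ b ∷ R ; loop = a ∷ Q ; base = tl a
      ; outer-chain = chain-++ P cP (sym same , cR)
      ; loop-chain  = refl , subst (Chain G _ Q) (sym same) cQ
      ; outer-all = ++⁺ aP (pb ∷ aR) ; loop-all = pa ∷ aQ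
      ; outer-shorter = shorter-cutLoop P Q R a b ; loop-shorter = shorter-loop P Q R a b
      ; cv-split = λ e → trans (cv-pieces e) (trans (regroup e)
          (sym (cong₂ ℤ._+_ (trans (cv-++ P (b ∷ R) e) (cong (λ z → cv P e ℤ.+ z) (cv-++ (b ∷ []) R e)))
                            (cv-++ (a ∷ []) Q e)))) }
      where
      open Pieces (pieces c al)
      regroup : ∀ e → cv P e ℤ.+ (cv (a ∷ []) e ℤ.+ (cv Q e ℤ.+ (cv (b ∷ []) e ℤ.+ cv R e)))
                    ≡ (cv P e ℤ.+ (cv (b ∷ []) e ℤ.+ cv R e)) ℤ.+ (cv (a ∷ []) e ℤ.+ cv Q e)
      regroup e = solve 5 (λ p a q b r → p :+ (a :+ (q :+ (b :+ r))) := (p :+ (b :+ r)) :+ (a :+ q))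
                    refl (cv P e) (cv (a ∷ []) e) (cv Q e) (cv (b ∷ []) e) (cv R e)

    -- backtrack: keep P ++ R, split off the closed walk Q; a and b cancel
    backtrackDetour : Reverse a b → Chain G x ds y → All Pr ds → Detour Pr x y ds
    backtrackDetour rev c al = record
      { outer = P ++ R ; loop = Q ; base = hd a
      ; outer-chain = chain-++ P cP (subst (λ z → Chain G z R y) hb≡ta cR)
      ; loop-chain  = subst (Chain G _ Q) tb≡ha cQ
      ; outer-all = ++⁺ aP aR ; loop-all = aQ
      ; outer-shorter = shorter-cutBoth P Q R a b ; loop-shorter = shorter-inner P Q R a b
      ; cv-split = λ e → trans (cv-pieces e) (trans (regroup e)
          (trans (cong (λ z → (cv P e ℤ.+ cv R e) ℤ.+ cv Q e ℤ.+ z) (reverse-cancels a b rev e))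
                 (trans (ℤₚ.+-identityʳ _) (cong (λ z → z ℤ.+ cv Q e) (sym (cv-++ P R e)))))) }
      where
      open Pieces (pieces c al)
      tb≡ha : tl b ≡ hd a
      tb≡ha = proj₁ (reverse-ends a b rev)
      hb≡ta : hd b ≡ tl a
      hb≡ta = proj₂ (reverse-ends a b rev)
      regroup : ∀ e → cv P e ℤ.+ (cv (a ∷ []) e ℤ.+ (cv Q e ℤ.+ (cv (b ∷ []) e ℤ.+ cv R e)))
                    ≡ (cv P e ℤ.+ cv R e) ℤ.+ cv Q e ℤ.+ (cv (a ∷ []) e ℤ.+ cv (b ∷ []) e)
      regroup e = solve 5 (λ p a q b r → p :+ (a :+ (q :+ (b :+ r)))
                                        := (p :+ r) :+ q :+ (a :+ b))
                    refl (cv P e) (cv (a ∷ []) e) (cv Q e) (cv (b ∷ []) e) (cv R e)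

  detour : ∀ {Pr x y ds} → Chain G x ds y → All Pr ds → Shortcut ds → Detour Pr x y ds
  detour c al (revisit   P Q R a b refl same) = revisitDetour   P Q R a b same c al
  detour c al (backtrack P Q R a b refl rev)  = backtrackDetour P Q R a b rev  c al

  -- In an acyclic edge set every closed walk has zero cycle vector: a
  -- simple nonempty closed walk would be a cycle, and a non-simple one is
  -- cut by a detour into two shorter closed walks.
  closedWalk-null : ∀ {S} → Acyclic S → ∀ {x} ds → Chain G x ds x → All (InS S) ds →
                    ∀ e → cv ds e ≡ + 0
  closedWalk-null {S} acyclic ds c al e = go ds c al (<-wellFounded (length ds))
    where
    go : ∀ {x} ds → Chain G x ds x → All (InS S) ds → Acc _<_ (length ds) → cv ds e ≡ + 0
    go []       c al _ = refl
    go (d ∷ ds) c al (acc rec) with simpleOrShortcut (d ∷ ds)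
    ... | inj₁ simple = ⊥-elim (acyclic (d ∷ ds) ((λ ()) , (_ , c) , simple) al)
    ... | inj₂ shortcut = trans (cv-split e)
          (cong₂ ℤ._+_ (go outer outer-chain outer-all (rec outer-shorter))
                       (go loop loop-chain loop-all (rec loop-shorter)))
      where open Detour (detour c al shortcut)

  record SimplePath (S : EdgeSet m) (x y : Fin n) : Set where
    field
      path     : List (Dart G)
      chain    : Chain G x path y
      inS      : All (InS S) path
      simple   : Simple path
      end-last : y ∉ map tl path

  -- Any walk inside S can be shortened to a simple path: cut it before the
  -- first visit of y, and remove detours.
  simplePath : ∀ {S x y} ds → Chain G x ds y → All (InS S) ds → SimplePath S x y
  simplePath {S} {x} {y} ds c al = go ds c al (<-wellFounded (length ds))
    where
    go : ∀ ds → Chain G x ds y → All (InS S) ds → Acc _<_ (length ds) → SimplePath S x y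
    go ds c al (acc rec) with any? (λ d → y ≟ᶠ tl d) ds
    ... | yes hit with find hit
    ...   | d , d∈ , y≡td with ∈-∃++ d∈
    ...     | Pre , Post , refl with chain-split Pre c
    ...       | _ , c-pre , (td≡ , _) =
      go Pre (subst (Chain G x Pre) (trans (sym td≡) (sym y≡td)) c-pre) (proj₁ (++⁻ Pre al))
         (rec (shorter-prefix Pre Post d))
    go ds c al (acc rec) | no miss with simpleOrShortcut ds
    ... | inj₁ simple   = record { path = ds ; chain = c ; inS = al ; simple = simple
                                 ; end-last = λ y∈ → miss (Any.map⁻ y∈) }
    ... | inj₂ shortcut = go outer outer-chain outer-all (rec outer-shorter)
      where open Detour (detour c al shortcut)

  module _ {S : EdgeSet m} where
    reachWalk : ∀ {x y} → Reach src tgt S x y → ∃[ ds ] (Chain G x ds y × All (InS S) ds)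
    reachWalk here = [] , refl , []
    reachWalk (fwd e t r) with reachWalk r
    ... | ds , c , al = (e , true) ∷ ds , (refl , c) , t ∷ al
    reachWalk (bwd e t r) with reachWalk r
    ... | ds , c , al = (e , false) ∷ ds , (refl , c) , t ∷ al

    reach-trans : ∀ {x y z} → Reach src tgt S x y → Reach src tgt S y z → Reach src tgt S x z
    reach-trans here        r′ = r′
    reach-trans (fwd e t r) r′ = fwd e t (reach-trans r r′)
    reach-trans (bwd e t r) r′ = bwd e t (reach-trans r r′)

    reach-sym : ∀ {x y} → Reach src tgt S x y → Reach src tgt S y x
    reach-sym here        = here
    reach-sym (fwd e t r) = reach-trans (reach-sym r) (bwd e t here)
    reach-sym (bwd e t r) = reach-trans (reach-sym r) (fwd e t here)

  reach-mono : ∀ {S S′ : EdgeSet m} → (∀ e → T (S e) → T (S′ e)) →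
               ∀ {x y} → Reach src tgt S x y → Reach src tgt S′ x y
  reach-mono S⊆S′ here        = here
  reach-mono S⊆S′ (fwd e t r) = fwd e (S⊆S′ e t) (reach-mono S⊆S′ r)
  reach-mono S⊆S′ (bwd e t r) = bwd e (S⊆S′ e t) (reach-mono S⊆S′ r)

  cv-avoiding : ∀ ds f → All (λ d → ed d ≢ f) ds → cv ds f ≡ + 0
  cv-avoiding []       f []         = refl
  cv-avoiding (d ∷ ds) f (d≢ ∷ ds≢) with ed d ≟ᶠ f
  ... | yes d≡ = ⊥-elim (d≢ d≡)
  ... | no  _  = cv-avoiding ds f ds≢

  module FundamentalCycles {S : EdgeSet m} (spanning : IsSpanningTree G S) where
    treePath : ∀ e → SimplePath S (tgt e) (src e)
    treePath e with reachWalk (proj₁ spanning (tgt e) (src e))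
    ... | ds , c , al = simplePath ds c al

    fundamental : Fin m → List (Dart G)
    fundamental e = (e , true) ∷ SimplePath.path (treePath e)

    fundamental-closed : ∀ e → Chain G (src e) (fundamental e) (src e)
    fundamental-closed e = refl , SimplePath.chain (treePath e)

    treePath-avoids : ∀ e f → S f ≡ false → All (λ d → ed d ≢ f) (SimplePath.path (treePath e))
    treePath-avoids e f Sf = All.map (λ {d} inS d≡f → subst T (trans (cong S d≡f) Sf) inS)
                                     (SimplePath.inS (treePath e))

    fundamental-isCycle : ∀ e → S e ≡ false → IsCycleWalk G (fundamental e)
    fundamental-isCycle e Se =
      (λ ()) , (src e , fundamental-closed e)
      , (¬Any⇒All¬ _ end-last ∷ proj₁ simple)
      , (All.map⁺ (All.map (λ d≢e e≡d → d≢e (sym e≡d)) (treePath-avoids e e Se)) ∷ proj₂ simple)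
      where open SimplePath (treePath e)

    fundamental-self : ∀ e → S e ≡ false → cv (fundamental e) e ≡ + 1
    fundamental-self e Se with e ≟ᶠ e
    ... | yes _   = cong (λ z → + 1 ℤ.+ z) (cv-avoiding _ e (treePath-avoids e e Se))
    ... | no e≢e = ⊥-elim (e≢e refl)

    fundamental-other : ∀ e f → S f ≡ false → e ≢ f → cv (fundamental e) f ≡ + 0
    fundamental-other e f Sf e≢f with e ≟ᶠ f
    ... | yes e≡f = ⊥-elim (e≢f e≡f)
    ... | no  _   = cv-avoiding _ f (treePath-avoids e f Sf)

  lastDart : ∀ {x y} d ds → Chain G x (d ∷ ds) y → ∃[ d′ ] (d′ ∈ d ∷ ds × hd d′ ≡ y)
  lastDart d []         (_ , hd≡) = d , here refl , hd≡
  lastDart d (d₂ ∷ ds) (_ , c) with lastDart d₂ ds c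
  ... | d′ , d′∈ , hd≡ = d′ , there d′∈ , hd≡

  successor : ∀ {x d} ds → Chain G x ds x → d ∈ ds → ∃[ d′ ] (d′ ∈ ds × tl d′ ≡ hd d)
  successor {x} {d} ds c d∈ with ∈-∃++ d∈
  ... | Pre , d′ ∷ Post , refl with chain-split Pre c
  ...   | _ , _ , (_ , (tl≡ , _)) = d′ , ∈-++⁺ʳ Pre (there (here refl)) , tl≡
  successor {x} {d} ds c d∈ | [] , [] , refl = d , here refl , trans (proj₁ c) (sym (proj₂ c))
  successor {x} {d} ds c d∈ | p ∷ Pre , [] , refl with chain-split (p ∷ Pre) c
  ... | _ , _ , (_ , hd≡x) = p , here refl , trans (proj₁ c) (sym hd≡x)

  predecessor : ∀ {x d} ds → Chain G x ds x → d ∈ ds → ∃[ d′ ] (d′ ∈ ds × hd d′ ≡ tl d)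
  predecessor {x} {d} ds c d∈ with ∈-∃++ d∈
  ... | []      , Post , refl with lastDart d Post c
  ...   | d′ , d′∈ , hd≡x = d′ , d′∈ , trans hd≡x (sym (proj₁ c))
  predecessor {x} {d} ds c d∈ | p ∷ Pre , Post , refl with chain-split (p ∷ Pre) c
  ... | _ , c-pre , (tl≡ , _) with lastDart p Pre c-pre
  ...   | d′ , d′∈ , hd≡ = d′ , ∈-++⁺ˡ d′∈ , trans hd≡ (sym tl≡)

  dart-noLoop : ∀ d → tl d ≢ hd d
  dart-noLoop (e , true)        = noLoop e
  dart-noLoop (e , false) t≡h = noLoop e (sym t≡h)

  sameEdge : ∀ d′ d → ed d′ ≡ ed d → (tl d′ ≡ tl d × hd d′ ≡ hd d) ⊎ (tl d′ ≡ hd d × hd d′ ≡ tl d)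
  sameEdge (e , false) (.e , false) refl = inj₁ (refl , refl)
  sameEdge (e , false) (.e , true)  refl = inj₂ (refl , refl)
  sameEdge (e , true)  (.e , false) refl = inj₂ (refl , refl)
  sameEdge (e , true)  (.e , true)  refl = inj₁ (refl , refl)

  insert : Fin m → EdgeSet m → EdgeSet m
  insert e S f = if does (f ≟ᶠ e) then true else S f

  insert-new : ∀ e S → T (insert e S e)
  insert-new e S with e ≟ᶠ e
  ... | yes _   = _
  ... | no e≢e = ⊥-elim (e≢e refl)

  insert-old : ∀ e S f → T (S f) → T (insert e S f)
  insert-old e S f t with f ≟ᶠ e
  ... | yes _ = _
  ... | no  _ = t

  insert-cases : ∀ e S f → T (insert e S f) → (f ≡ e) ⊎ T (S f)
  insert-cases e S f t with f ≟ᶠ e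
  ... | yes f≡e = inj₁ f≡e
  ... | no  _   = inj₂ t

  -- Attaching to an acyclic S a new edge whose head v = hd d is untouched
  -- by S keeps it acyclic: a cycle through the new edge enters and leaves v,
  -- so it would use a second edge at v, which must belong to S.
  module _ {S : EdgeSet m} (d : Dart G) (acyclic : Acyclic S)
           (untouched : ∀ d′ → InS S d′ → tl d′ ≢ hd d × hd d′ ≢ hd d) where

    private
      secondDart : ∀ {ds} → Unique (map ed ds) → All (InS (insert (ed d) S)) ds →
                   ∀ {d′ d″} → d′ ∈ ds → ed d′ ≡ ed d → d″ ∈ ds → d″ ≢ d′ →
                   (tl d″ ≡ hd d) ⊎ (hd d″ ≡ hd d) → ⊥
      secondDart uE al {d′} {d″} d′∈ d′≡ d″∈ d″≢d′ touch
        with insert-cases (ed d) S (ed d″) (All.lookup al d″∈)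
      ... | inj₁ d″≡ = d″≢d′ (uniqueMap-injective ed uE d″∈ d′∈ (trans d″≡ (sym d′≡)))
      ... | inj₂ t   with touch
      ...   | inj₁ tl≡ = proj₁ (untouched d″ t) tl≡
      ...   | inj₂ hd≡ = proj₂ (untouched d″ t) hd≡

      notNew : ∀ {d′} → InS (insert (ed d) S) d′ → ed d′ ≢ ed d → InS S d′
      notNew {d′} t d′≢ with insert-cases (ed d) S (ed d′) t
      ... | inj₁ d′≡ = ⊥-elim (d′≢ d′≡)
      ... | inj₂ t′  = t′

    attach-acyclic : Acyclic (insert (ed d) S)
    attach-acyclic ds cyc@(_ , (_ , c) , _ , uE) al with any? (λ d′ → ed d′ ≟ᶠ ed d) ds
    ... | no avoid = acyclic ds cyc (All.zipWith (λ {d′} (t , d′≢) → notNew {d′} t d′≢) (al , ¬Any⇒All¬ ds avoid))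
    ... | yes hit with find hit
    ...   | d′ , d′∈ , d′≡ with sameEdge d′ d d′≡
    ...     | inj₁ (_ , hd′≡v) with successor ds c d′∈
    ...       | d″ , d″∈ , tl″≡ = secondDart uE al d′∈ d′≡ d″∈
                  (λ { refl → dart-noLoop d′ tl″≡ }) (inj₁ (trans tl″≡ hd′≡v))
    attach-acyclic ds cyc@(_ , (_ , c) , _ , uE) al | yes _ | d′ , d′∈ , d′≡ | inj₂ (tl′≡v , _)
      with predecessor ds c d′∈
    ... | d″ , d″∈ , hd″≡ = secondDart uE al d′∈ d′≡ d″∈
            (λ { refl → dart-noLoop d′ (sym hd″≡) }) (inj₂ (trans hd″≡ tl′≡v))

-- a finite type is inhabited or empty (graphs may have no vertices)
vertexOrNone : ∀ k → Fin k ⊎ ¬ Fin k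
vertexOrNone Nat.zero    = inj₂ λ ()
vertexOrNone (Nat.suc k) = inj₁ Fin.zero

-- From a root r we grow a tree: as long as
-- some dart leaves its vertex set V, attach that dart's edge (which keeps it
-- acyclic by attach-acyclic).  Each step enlarges V, and when no dart
-- leaves V, connectivity forces V to contain every vertex.
module SpanningTrees (G : Graph) where
  open Nat using (zero; suc; _+_; _≤_)
  open Natₚ using (≤-trans; ≤-antisym; m≤m+n; +-suc; +-monoʳ-≤)
  open Graph G
  open Walks G
  open ≡ using (refl; sym; trans; subst)

  empty-acyclic : Acyclic (λ _ → false)
  empty-acyclic []      (nonempty , _) _        = nonempty refl
  empty-acyclic (_ ∷ _) _              (() ∷ _)

  dartStep : ∀ {S} d → InS S d → Reach src tgt S (tl d) (hd d)
  dartStep (e , true)  t = fwd e t here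
  dartStep (e , false) t = bwd e t here

  record Grown (r : Fin n) : Set where
    field
      V       : Subset n
      S       : EdgeSet m
      root∈   : r ∈ᵥ V
      reaches : ∀ x → x ∈ᵥ V → Reach src tgt S r x
      inside  : ∀ d → InS S d → tl d ∈ᵥ V × hd d ∈ᵥ V
      acyclic : Acyclic S

  Leaving : Subset n → Dart G → Set
  Leaving V d = tl d ∈ᵥ V × hd d ∉ᵥ V

  leavingDart? : ∀ V → (∃[ d ] Leaving V d) ⊎ (∀ d → ¬ Leaving V d)
  leavingDart? V with anyFin? (λ e → leaving? (e , true) ⊎-dec leaving? (e , false))
    where
    leaving? : ∀ d → Dec (Leaving V d)
    leaving? d = (tl d ∈? V) ×-dec ¬? (hd d ∈? V)
  ... | yes (e , inj₁ l) = inj₁ ((e , true) , l)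
  ... | yes (e , inj₂ l) = inj₁ ((e , false) , l)
  ... | no none = inj₂ λ { (e , true) l → none (e , inj₁ l) ; (e , false) l → none (e , inj₂ l) }

  stays : ∀ {V} → (∀ d → ¬ Leaving V d) → ∀ {x y} ds → Chain G x ds y → x ∈ᵥ V → y ∈ᵥ V
  stays         noExit []       refl      x∈ = x∈
  stays {V} noExit (d ∷ ds) (refl , c) x∈ with hd d ∈? V
  ... | yes hd∈ = stays noExit ds c hd∈
  ... | no  hd∉ = ⊥-elim (noExit d (x∈ , hd∉))

  module _ {r : Fin n} where
    seed : Grown r
    seed = record
      { V = ⁅ r ⁆ ; S = λ _ → false ; root∈ = x∈⁅x⁆ r
      ; reaches = λ x x∈ → subst (Reach src tgt _ r) (sym (x∈⁅y⁆⇒x≡y r x∈)) here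
      ; inside = λ _ () ; acyclic = empty-acyclic }

    attach : (t : Grown r) (d : Dart G) → Leaving (Grown.V t) d → Grown r
    attach t d (tl∈ , hd∉) = record
      { V = V ∪ ⁅ hd d ⁆ ; S = insert (ed d) S ; root∈ = old root∈
      ; reaches = reaches′ ; inside = inside′
      ; acyclic = attach-acyclic d acyclic λ d′ t′ →
          (λ tl≡ → hd∉ (subst (_∈ᵥ V) tl≡ (proj₁ (inside d′ t′))))
        , (λ hd≡ → hd∉ (subst (_∈ᵥ V) hd≡ (proj₂ (inside d′ t′)))) }
      where
      open Grown t
      old : ∀ {x} → x ∈ᵥ V → x ∈ᵥ V ∪ ⁅ hd d ⁆
      old = p⊆p∪q _
      new : hd d ∈ᵥ V ∪ ⁅ hd d ⁆
      new = q⊆p∪q V _ (x∈⁅x⁆ (hd d))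
      reaches′ : ∀ x → x ∈ᵥ V ∪ ⁅ hd d ⁆ → Reach src tgt (insert (ed d) S) r x
      reaches′ x x∈ with x∈p∪q⁻ V _ x∈
      ... | inj₁ x∈V = reach-mono (insert-old (ed d) S) (reaches x x∈V)
      ... | inj₂ x∈v = subst (Reach src tgt _ r) (sym (x∈⁅y⁆⇒x≡y _ x∈v))
          (reach-trans (reach-mono (insert-old (ed d) S) (reaches _ tl∈)) (dartStep d (insert-new (ed d) S)))
      inside′ : ∀ d′ → InS (insert (ed d) S) d′ → tl d′ ∈ᵥ V ∪ ⁅ hd d ⁆ × hd d′ ∈ᵥ V ∪ ⁅ hd d ⁆
      inside′ d′ t′ with insert-cases (ed d) S (ed d′) t′
      ... | inj₂ t″ = old (proj₁ (inside d′ t″)) , old (proj₂ (inside d′ t″))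
      ... | inj₁ d′≡ with sameEdge d′ d d′≡
      ...   | inj₁ (tl≡ , hd≡) = subst (_∈ᵥ _) (sym tl≡) (old tl∈) , subst (_∈ᵥ _) (sym hd≡) new
      ...   | inj₂ (tl≡ , hd≡) = subst (_∈ᵥ _) (sym tl≡) new , subst (_∈ᵥ _) (sym hd≡) (old tl∈)

    attach-grows : ∀ t d (l : Leaving (Grown.V t) d) → suc ∣ Grown.V t ∣ ≤ ∣ Grown.V (attach t d l) ∣
    attach-grows t d (_ , hd∉) = p⊂q⇒∣p∣<∣q∣ (p⊆p∪q _ , hd d , q⊆p∪q (Grown.V t) _ (x∈⁅x⁆ (hd d)) , hd∉)

    spanning : (t : Grown r) → (∀ x → x ∈ᵥ Grown.V t) → IsSpanningTree G (Grown.S t)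
    spanning t all = (λ x y → reach-trans (reach-sym (reaches x (all x))) (reaches y (all y))) , acyclic
      where open Grown t

    -- grow for at most k more steps, where n ≤ k + |V|
    grow : ∀ k (t : Grown r) → n ≤ k + ∣ Grown.V t ∣ → ∃[ S ] IsSpanningTree G S
    grow zero    t n≤|V| = Grown.S t , spanning t λ x →
      subst (x ∈ᵥ_) (sym (∣p∣≡n⇒p≡⊤ (≤-antisym (∣p∣≤n (Grown.V t)) n≤|V|))) ∈⊤
    grow (suc k) t n≤ with leavingDart? (Grown.V t)
    ... | inj₁ (d , l) = grow k t′ (≤-trans n≤ (subst (_≤ k + ∣ Grown.V t′ ∣) (+-suc k ∣ Grown.V t ∣)
                                                       (+-monoʳ-≤ k (attach-grows t d l))))
      where t′ = attach t d l
    ... | inj₂ noExit = Grown.S t , spanning t λ x →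
          stays noExit _ (proj₁ (proj₂ (reachWalk (connected r x)))) (Grown.root∈ t)

  spanningTree : ∃[ S ] IsSpanningTree G S
  spanningTree with vertexOrNone n
  ... | inj₁ r    = grow {r} n seed (m≤m+n n _)
  ... | inj₂ none = (λ _ → false) , (λ x → ⊥-elim (none x)) , empty-acyclic

module FieldFacts (R : RealField) where
  open RealField R
  open IsStrictTotalOrder <-isStrictTotalOrder using (compare; irrefl; <-respʳ-≈; <-respˡ-≈)
    renaming (trans to <-trans)
  open import Algebra.Properties.Ring ring public using (-‿involutive; -‿+-comm; -‿distribˡ-*; -‿distribʳ-*)
  open import Algebra.Properties.AbelianGroup +-abelianGroup using (inverseˡ-unique)
  open import Algebra.Properties.Semiring.Sum semiring public
    using (sum; sum-cong-≋; ∑-distrib-+; *-distribˡ-sum; sum-replicate-zero)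
  open import Relation.Binary.Reasoning.Setoid setoid

  module Normalise = NonReflective (ACR.fromCommutativeRing commRing (λ _ → nothing))
  open Normalise public using (solve; _⊕_; _⊜_)

  -0≈0 : - 0# ≈ 0#
  -0≈0 = trans (sym (+-identityˡ (- 0#))) (-‿inverseʳ 0#)

  [x-y]+y≈x : ∀ x y → (x - y) + y ≈ x
  [x-y]+y≈x x y = trans (+-assoc x (- y) y) (trans (+-cong refl (-‿inverseˡ y)) (+-identityʳ x))

  difference-of-zeros : ∀ {a b x q} → a + (x + q) ≈ 0# → b + q ≈ 0# → b - a ≈ x
  difference-of-zeros {a} {b} {x} {q} a+x+q≈0 b+q≈0 = begin
    b - a              ≈⟨ +-cong (inverseˡ-unique b q b+q≈0) (-‿cong (inverseˡ-unique a _ a+x+q≈0)) ⟩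
    - q - - (x + q)    ≈⟨ +-cong refl (-‿involutive _) ⟩
    - q + (x + q)      ≈⟨ solve 3 (λ nq x q → (nq ⊕ (x ⊕ q)) ⊜ (x ⊕ (q ⊕ nq))) refl (- q) x q ⟩
    x + (q - q)        ≈⟨ +-cong refl (-‿inverseʳ q) ⟩
    x + 0#             ≈⟨ +-identityʳ x ⟩
    x                  ∎

  <-≈ : ∀ {x y z} → x < y → y ≈ z → x < z
  <-≈ x<y y≈z = <-respʳ-≈ y≈z x<y

  ≤-trans : ∀ {x y z} → x ≤ y → y ≤ z → x ≤ z
  ≤-trans (inj₁ x<y) (inj₁ y<z) = inj₁ (<-trans x<y y<z)
  ≤-trans (inj₁ x<y) (inj₂ y≈z) = inj₁ (<-≈ x<y y≈z)
  ≤-trans (inj₂ x≈y) (inj₁ y<z) = inj₁ (<-respˡ-≈ (sym x≈y) y<z)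
  ≤-trans (inj₂ x≈y) (inj₂ y≈z) = inj₂ (trans x≈y y≈z)

  pos≉0 : ∀ {x} → 0# < x → ¬ (x ≈ 0#)
  pos≉0 0<x x≈0 = irrefl (sym x≈0) 0<x

  <-≤ : ∀ {x y z} → x < y → y ≤ z → x < z
  <-≤ x<y (inj₁ y<z) = <-trans x<y y<z
  <-≤ x<y (inj₂ y≈z) = <-≈ x<y y≈z

  ≤-+-nonneg : ∀ {a c} → 0# ≤ c → a ≤ (c + a)
  ≤-+-nonneg {a} (inj₁ 0<c) = inj₁ (<-respˡ-≈ (+-identityˡ a) (+-mono-< a 0<c))
  ≤-+-nonneg {a} (inj₂ 0≈c) = inj₂ (trans (sym (+-identityˡ a)) (+-cong 0≈c refl))

  neg-pos : ∀ {x} → x < 0# → 0# < (- x)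
  neg-pos {x} x<0 = <-respˡ-≈ (-‿inverseʳ x) (<-≈ (+-mono-< (- x) x<0) (+-identityˡ (- x)))

  square-nonneg : ∀ x → 0# ≤ (x * x)
  square-nonneg x with compare 0# x
  ... | tri< 0<x _ _ = inj₁ (*-pos 0<x 0<x)
  ... | tri≈ _ 0≈x _ = inj₂ (sym (trans (*-cong (sym 0≈x) refl) (zeroˡ x)))
  ... | tri> _ _ x<0 = inj₁ (<-≈ (*-pos (neg-pos x<0) (neg-pos x<0)) (begin
      - x * - x     ≈⟨ sym (-‿distribˡ-* x (- x)) ⟩
      - (x * - x)   ≈⟨ -‿cong (sym (-‿distribʳ-* x x)) ⟩
      - (- (x * x)) ≈⟨ -‿involutive _ ⟩
      x * x         ∎))

  0<1 : 0# < 1#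
  0<1 with square-nonneg 1#
  ... | inj₁ 0<1·1 = <-≈ 0<1·1 (*-identityʳ 1#)
  ... | inj₂ 0≈1·1 = ⊥-elim (0≉1 (trans 0≈1·1 (*-identityʳ 1#)))

  sum-zero : ∀ {k} {f : Fin k → Carrier} → (∀ i → f i ≈ 0#) → sum f ≈ 0#
  sum-zero {k} f≈0 = trans (sum-cong-≋ f≈0) (sum-replicate-zero k)

  sum-neg : ∀ {k} (f : Fin k → Carrier) → sum (λ i → - f i) ≈ - sum f
  sum-neg {Nat.zero}  f = sym -0≈0
  sum-neg {Nat.suc k} f = trans (+-cong refl (sum-neg (λ i → f (Fin.suc i)))) (-‿+-comm _ _)

  sum-single : ∀ {k} (p : Fin k) {f : Fin k → Carrier} → (∀ i → i ≢ p → f i ≈ 0#) → sum f ≈ f p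
  sum-single Fin.zero     f≈0 =
    trans (+-cong refl (sum-zero (λ i → f≈0 (Fin.suc i) (λ ())))) (+-identityʳ _)
  sum-single (Fin.suc p) f≈0 =
    trans (+-cong (f≈0 Fin.zero (λ ())) (sum-single p (λ i i≢p → f≈0 (Fin.suc i) (i≢p ∘ suc-injective))))
          (+-identityˡ _)

  sum-nonneg : ∀ {k} {f : Fin k → Carrier} → (∀ i → 0# ≤ f i) → 0# ≤ sum f
  sum-nonneg {Nat.zero}  _   = inj₂ refl
  sum-nonneg {Nat.suc k} f≥0 = ≤-trans (sum-nonneg (f≥0 ∘ Fin.suc)) (≤-+-nonneg (f≥0 Fin.zero))

  sum-≥-term : ∀ {k} (p : Fin k) {f : Fin k → Carrier} → (∀ i → 0# ≤ f i) → f p ≤ sum f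
  sum-≥-term Fin.zero     f≥0 =
    ≤-trans (≤-+-nonneg (sum-nonneg (f≥0 ∘ Fin.suc))) (inj₂ (+-comm _ _))
  sum-≥-term (Fin.suc p) f≥0 = ≤-trans (sum-≥-term p (f≥0 ∘ Fin.suc)) (≤-+-nonneg (f≥0 Fin.zero))

module IntegerMultiples (G : Graph) (R : RealField) where
  open RealField R
  open FieldFacts R
  open import Algebra.Properties.CommutativeMonoid.Mult +-commutativeMonoid using (×-congʳ; ×-distrib-+)
    renaming (_×_ to _·ℕ_)
  open import Algebra.Properties.Semiring.Mult semiring using (×-comm-*)
  open import Relation.Binary.Reasoning.Setoid setoid

  nm : ℕ → Carrier → Carrier
  nm = nmul G R

  zm : ℤ → Carrier → Carrier
  zm = zmul G R

  nmul≡× : ∀ k x → nm k x ≡ k ·ℕ x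
  nmul≡× Nat.zero    x = ≡.refl
  nmul≡× (Nat.suc k) x = ≡.cong (λ y → x + y) (nmul≡× k x)

  nmul-* : ∀ k x → nm k x ≈ x * nm k 1#
  nmul-* k x rewrite nmul≡× k x | nmul≡× k 1# = sym (trans (×-comm-* k x 1#) (×-congʳ k (*-identityʳ x)))

  zmul-cong : ∀ z {x y} → x ≈ y → zm z x ≈ zm z y
  zmul-cong (+ k)    {x} {y} x≈y rewrite nmul≡× k x | nmul≡× k y = ×-congʳ k x≈y
  zmul-cong -[1+ k ] {x} {y} x≈y rewrite nmul≡× k x | nmul≡× k y = -‿cong (+-cong x≈y (×-congʳ k x≈y))

  zmul-+ : ∀ z x y → zm z (x + y) ≈ zm z x + zm z y
  zmul-+ (+ k) x y rewrite nmul≡× k (x + y) | nmul≡× k x | nmul≡× k y = ×-distrib-+ x y k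
  zmul-+ -[1+ k ] x y rewrite nmul≡× k (x + y) | nmul≡× k x | nmul≡× k y =
    trans (-‿cong (×-distrib-+ x y (Nat.suc k))) (sym (-‿+-comm _ _))

  zmul-* : ∀ z x → zm z x ≈ x * zm z 1#
  zmul-* (+ k)    x = nmul-* k x
  zmul-* -[1+ k ] x = trans (-‿cong (nmul-* (Nat.suc k) x)) (-‿distribʳ-* x _)

  zmul-0 : ∀ z → zm z 0# ≈ 0#
  zmul-0 z = trans (zmul-* z 0#) (zeroˡ _)

  zmul-sign : ∀ d z x → zm (signD G d ℤ.+ z) x ≈ zm (signD G d) x + zm z x
  zmul-sign (_ , true)  (+ k)            x = +-cong (sym (+-identityʳ x)) refl
  zmul-sign (_ , true)  -[1+ Nat.zero ]  x = sym (-‿inverseʳ _)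
  zmul-sign (_ , true)  -[1+ Nat.suc k ] x = sym (begin
    (x + 0#) + - (x + (x + nm k x)) ≈⟨ +-cong (+-identityʳ x) (sym (-‿+-comm x _)) ⟩
    x + (- x + - (x + nm k x))      ≈⟨ sym (+-assoc x (- x) _) ⟩
    (x - x) + - (x + nm k x)        ≈⟨ +-cong (-‿inverseʳ x) refl ⟩
    0# + - (x + nm k x)             ≈⟨ +-identityˡ _ ⟩
    - (x + nm k x)                  ∎)
  zmul-sign (_ , false) (+ Nat.zero)     x = sym (+-identityʳ _)
  zmul-sign (_ , false) (+ Nat.suc k)    x = sym (begin
    - (x + 0#) + (x + nm k x) ≈⟨ +-cong (-‿cong (+-identityʳ x)) refl ⟩
    - x + (x + nm k x)        ≈⟨ sym (+-assoc (- x) x _) ⟩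
    (- x + x) + nm k x        ≈⟨ +-cong (-‿inverseˡ x) refl ⟩
    0# + nm k x               ≈⟨ +-identityˡ _ ⟩
    nm k x                    ∎)
  zmul-sign (_ , false) -[1+ k ]         x = begin
    - (x + (x + nm k x))        ≈⟨ sym (-‿+-comm x _) ⟩
    - x + - (x + nm k x)        ≈⟨ +-cong (-‿cong (sym (+-identityʳ x))) refl ⟩
    - (x + 0#) + - (x + nm k x) ∎

-- The proof adjoins one pivot p at a time: orthogonalise
-- u p against the span of the others (Gram–Schmidt); the residual v has
-- p-coordinate 1, hence ⟨v, u p⟩ = ⟨v, v⟩ > 0, and adding a multiple of v
-- corrects the p-th equation without disturbing the others.
module GramSystems (R : RealField) {k : ℕ} (u : Fin k → Fin k → RealField.Carrier R) where
  open RealField R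
  open FieldFacts R
  open import Relation.Binary.Reasoning.Setoid setoid

  Vector : Set
  Vector = Fin k → Carrier

  ⟨_,_⟩ : Vector → Vector → Carrier
  ⟨ x , y ⟩ = sum (λ f → x f * y f)

  combination : List (Fin k) → (Fin k → Carrier) → Vector
  combination es β f = foldr (λ e acc → β e * u e f + acc) 0# es

  ⟨⟩-sym : ∀ x y → ⟨ x , y ⟩ ≈ ⟨ y , x ⟩
  ⟨⟩-sym x y = sum-cong-≋ (λ f → *-comm (x f) (y f))

  ⟨⟩-congˡ : ∀ {x x′} z → (∀ f → x f ≈ x′ f) → ⟨ x , z ⟩ ≈ ⟨ x′ , z ⟩
  ⟨⟩-congˡ z x≈x′ = sum-cong-≋ (λ f → *-cong (x≈x′ f) refl)

  ⟨⟩-+ˡ : ∀ x y z → ⟨ (λ f → x f + y f) , z ⟩ ≈ ⟨ x , z ⟩ + ⟨ y , z ⟩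
  ⟨⟩-+ˡ x y z = trans (sum-cong-≋ (λ f → distribʳ (z f) (x f) (y f))) (∑-distrib-+ (λ f → x f * z f) (λ f → y f * z f))

  ⟨⟩-*ˡ : ∀ c x z → ⟨ (λ f → c * x f) , z ⟩ ≈ c * ⟨ x , z ⟩
  ⟨⟩-*ˡ c x z = trans (sum-cong-≋ (λ f → *-assoc c (x f) (z f))) (sym (*-distribˡ-sum c (λ f → x f * z f)))

  ⟨⟩-negˡ : ∀ x z → ⟨ (λ f → - x f) , z ⟩ ≈ - ⟨ x , z ⟩
  ⟨⟩-negˡ x z = trans (sum-cong-≋ (λ f → sym (-‿distribˡ-* (x f) (z f)))) (sum-neg (λ f → x f * z f))

  ⟨combination⟩ : ∀ es β z → ⟨ combination es β , z ⟩ ≈ foldr (λ e acc → β e * ⟨ u e , z ⟩ + acc) 0# es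
  ⟨combination⟩ []       β z = sum-zero (λ f → zeroˡ (z f))
  ⟨combination⟩ (e ∷ es) β z =
    trans (⟨⟩-+ˡ _ _ z) (+-cong (⟨⟩-*ˡ (β e) (u e) z) (⟨combination⟩ es β z))

  foldr-vanishing : ∀ es (β g : Fin k → Carrier) → (∀ e → e ∈ es → g e ≈ 0#) →
                    foldr (λ e acc → β e * g e + acc) 0# es ≈ 0#
  foldr-vanishing []       β g _   = refl
  foldr-vanishing (e ∷ es) β g g≈0 =
    trans (+-cong (trans (*-cong refl (g≈0 e (here ≡.refl))) (zeroʳ (β e)))
                  (foldr-vanishing es β g (λ e′ e′∈ → g≈0 e′ (there e′∈))))
          (+-identityʳ 0#)

  combination-cong : ∀ es {β β′} → (∀ e → e ∈ es → β e ≈ β′ e) →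
                     ∀ f → combination es β f ≈ combination es β′ f
  combination-cong []       _    f = refl
  combination-cong (e ∷ es) β≈β′ f =
    +-cong (*-cong (β≈β′ e (here ≡.refl)) refl) (combination-cong es (λ e′ e′∈ → β≈β′ e′ (there e′∈)) f)

  combination-linear : ∀ es (a b : Fin k → Carrier) c f →
    combination es (λ e → a e + c * b e) f ≈ combination es a f + c * combination es b f
  combination-linear []       a b c f = sym (trans (+-cong refl (zeroʳ c)) (+-identityʳ 0#))
  combination-linear (e ∷ es) a b c f = begin
    (a e + c * b e) * u e f + combination es (λ e → a e + c * b e) f
      ≈⟨ +-cong (trans (distribʳ (u e f) (a e) (c * b e)) (+-cong refl (*-assoc c (b e) (u e f))))
                (combination-linear es a b c f) ⟩
    (a e * u e f + c * (b e * u e f)) + (combination es a f + c * combination es b f)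
      ≈⟨ solve 4 (λ p q r s → ((p ⊕ q) ⊕ (r ⊕ s)) ⊜ ((p ⊕ r) ⊕ (q ⊕ s))) refl _ _ _ _ ⟩
    (a e * u e f + combination es a f) + (c * (b e * u e f) + c * combination es b f)
      ≈⟨ +-cong refl (sym (distribˡ c _ _)) ⟩
    (a e * u e f + combination es a f) + c * (b e * u e f + combination es b f) ∎

  Pivots : List (Fin k) → Set
  Pivots es = (∀ e → e ∈ es → u e e ≈ 1#) × (∀ e e′ → e ∈ es → e′ ∈ es → e ≢ e′ → u e e′ ≈ 0#)

  Solvable : List (Fin k) → Set
  Solvable es = ∀ (α : Fin k → Carrier) → ∃[ β ] (∀ e → e ∈ es → ⟨ combination es β , u e ⟩ ≈ α e)

  module Adjoin (p : Fin k) (es : List (Fin k)) (p-fresh : All (p ≢_) es)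
                (pivots : Pivots (p ∷ es)) (solvable-es : Solvable es) where

    -- the orthogonal projection π of u p onto the span of es, and the residual v
    γ : Fin k → Carrier
    γ = proj₁ (solvable-es (λ e → ⟨ u p , u e ⟩))

    π v : Vector
    π = combination es γ
    v f = u p f - π f

    v-orthogonal : ∀ e → e ∈ es → ⟨ v , u e ⟩ ≈ 0#
    v-orthogonal e e∈ = begin
      ⟨ v , u e ⟩                       ≈⟨ trans (⟨⟩-+ˡ _ _ _) (+-cong refl (⟨⟩-negˡ _ _)) ⟩
      ⟨ u p , u e ⟩ - ⟨ π , u e ⟩       ≈⟨ +-cong refl (-‿cong (proj₂ (solvable-es _) e e∈)) ⟩
      ⟨ u p , u e ⟩ - ⟨ u p , u e ⟩     ≈⟨ -‿inverseʳ _ ⟩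
      0#                                ∎

    v-at-p : v p ≈ 1#
    v-at-p = trans (+-cong (proj₁ pivots p (here ≡.refl)) (trans (-‿cong π-at-p) -0≈0)) (+-identityʳ 1#)
      where
      π-at-p : π p ≈ 0#
      π-at-p = foldr-vanishing es γ (λ e → u e p) λ e e∈ →
        proj₂ pivots e p (there e∈) (here ≡.refl) (λ e≡p → All.lookup p-fresh e∈ (≡.sym e≡p))

    D : Carrier
    D = ⟨ v , u p ⟩

    D-positive : 0# < D
    D-positive = <-≈ (<-≤ 0<v²ₚ (sum-≥-term p (λ f → square-nonneg (v f)))) (sym D≈⟨v,v⟩)
      where
      0<v²ₚ : 0# < (v p * v p)
      0<v²ₚ = <-≈ 0<1 (sym (trans (*-cong v-at-p v-at-p) (*-identityʳ 1#)))
      ⟨v,π⟩≈0 : ⟨ v , π ⟩ ≈ 0#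
      ⟨v,π⟩≈0 = trans (⟨⟩-sym v π) (trans (⟨combination⟩ es γ v)
        (foldr-vanishing es γ _ (λ e e∈ → trans (⟨⟩-sym (u e) v) (v-orthogonal e e∈))))
      D≈⟨v,v⟩ : D ≈ ⟨ v , v ⟩
      D≈⟨v,v⟩ = begin
        ⟨ v , u p ⟩           ≈⟨ ⟨⟩-sym v (u p) ⟩
        ⟨ u p , v ⟩           ≈⟨ ⟨⟩-congˡ v (λ f → sym ([x-y]+y≈x (u p f) (π f))) ⟩
        ⟨ (λ f → v f + π f) , v ⟩ ≈⟨ ⟨⟩-+ˡ v π v ⟩
        ⟨ v , v ⟩ + ⟨ π , v ⟩ ≈⟨ +-cong refl (trans (⟨⟩-sym π v) ⟨v,π⟩≈0) ⟩
        ⟨ v , v ⟩ + 0#        ≈⟨ +-identityʳ _ ⟩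
        ⟨ v , v ⟩             ∎

    module _ (α : Fin k → Carrier) where
      δ : Fin k → Carrier
      δ = proj₁ (solvable-es α)

      w′ : Vector
      w′ = combination es δ

      D-invertible : ∃[ y ] (D * y ≈ 1#)
      D-invertible = inverse D (pos≉0 D-positive)

      D⁻¹ : Carrier
      D⁻¹ = proj₁ D-invertible

      t : Carrier
      t = (α p - ⟨ w′ , u p ⟩) * D⁻¹

      β : Fin k → Carrier
      β e = if does (p ≟ᶠ e) then t else δ e + (- t) * γ e

      combination-β : ∀ f → combination (p ∷ es) β f ≈ t * v f + w′ f
      combination-β f = begin
        β p * u p f + combination es β f
          ≈⟨ +-cong (*-cong β-at-p refl) (combination-cong es β-on-es f) ⟩
        t * u p f + combination es (λ e → δ e + (- t) * γ e) f
          ≈⟨ +-cong refl (combination-linear es δ γ (- t) f) ⟩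
        t * u p f + (w′ f + (- t) * π f)
          ≈⟨ +-cong refl (+-cong refl (trans (sym (-‿distribˡ-* t (π f))) (-‿distribʳ-* t (π f)))) ⟩
        t * u p f + (w′ f + t * - π f)
          ≈⟨ solve 3 (λ a b c → (a ⊕ (b ⊕ c)) ⊜ ((a ⊕ c) ⊕ b)) refl _ _ _ ⟩
        (t * u p f + t * - π f) + w′ f
          ≈⟨ +-cong (sym (distribˡ t (u p f) (- π f))) refl ⟩
        t * v f + w′ f ∎
        where
        β-at-p : β p ≈ t
        β-at-p with p ≟ᶠ p
        ... | yes _   = refl
        ... | no p≢p = ⊥-elim (p≢p ≡.refl)
        β-on-es : ∀ e → e ∈ es → β e ≈ δ e + (- t) * γ e
        β-on-es e e∈ with p ≟ᶠ e
        ... | yes p≡e = ⊥-elim (All.lookup p-fresh e∈ p≡e)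
        ... | no  _   = refl

      ⟨β⟩ : ∀ z → ⟨ combination (p ∷ es) β , z ⟩ ≈ t * ⟨ v , z ⟩ + ⟨ w′ , z ⟩
      ⟨β⟩ z = trans (⟨⟩-congˡ z combination-β) (trans (⟨⟩-+ˡ _ _ z) (+-cong (⟨⟩-*ˡ t v z) refl))

      solves : ∀ e → e ∈ p ∷ es → ⟨ combination (p ∷ es) β , u e ⟩ ≈ α e
      solves e (there e∈) = begin
        ⟨ combination (p ∷ es) β , u e ⟩ ≈⟨ ⟨β⟩ (u e) ⟩
        t * ⟨ v , u e ⟩ + ⟨ w′ , u e ⟩   ≈⟨ +-cong (trans (*-cong refl (v-orthogonal e e∈)) (zeroʳ t))
                                                 (proj₂ (solvable-es α) e e∈) ⟩
        0# + α e                        ≈⟨ +-identityˡ _ ⟩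
        α e                             ∎
      solves .p (here ≡.refl) = begin
        ⟨ combination (p ∷ es) β , u p ⟩ ≈⟨ ⟨β⟩ (u p) ⟩
        t * D + A                       ≈⟨ +-cong (*-assoc _ D⁻¹ D) refl ⟩
        (α p - A) * (D⁻¹ * D) + A       ≈⟨ +-cong (*-cong refl (trans (*-comm D⁻¹ D) (proj₂ D-invertible))) refl ⟩
        (α p - A) * 1# + A              ≈⟨ +-cong (*-identityʳ _) refl ⟩
        (α p - A) + A                   ≈⟨ [x-y]+y≈x (α p) A ⟩
        α p                             ∎
        where
        A : Carrier
        A = ⟨ w′ , u p ⟩

    solvable : Solvable (p ∷ es)
    solvable α = β α , solves α

  gramSolvable : ∀ es → Unique es → Pivots es → Solvable es
  gramSolvable []       _               _      α = (λ _ → 0#) , λ _ ()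
  gramSolvable (p ∷ es) (p-fresh ∷ uq) pivots = Adjoin.solvable p es p-fresh pivots
    (gramSolvable es uq ((λ e e∈ → proj₁ pivots e (there e∈))
                        , (λ e e′ e∈ e′∈ → proj₂ pivots e e′ (there e∈) (there e′∈))))

module Pairing (G : Graph) (R : RealField) where
  open Graph G
  open RealField R
  open FieldFacts R
  open IntegerMultiples G R
  open Walks G using (tl; hd; ed; cv; InS; Acyclic; closedWalk-null; reachWalk)
  open import Relation.Binary.Reasoning.Setoid setoid

  sum-tabulate : ∀ {k} {A : Set} (h : Fin k → A) (g : A → Carrier) →
                 foldr (λ a acc → g a + acc) 0# (tabulate h) ≡ sum (λ i → g (h i))
  sum-tabulate {Nat.zero}  h g = ≡.refl
  sum-tabulate {Nat.suc k} h g = ≡.cong (λ s → g (h Fin.zero) + s) (sum-tabulate (h ∘ Fin.suc) g)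

  sumE≈sum : ∀ f → sumE G R f ≈ sum f
  sumE≈sum f = reflexive (sum-tabulate (λ e → e) f)

  sumE-cong : ∀ {f g} → (∀ e → f e ≈ g e) → sumE G R f ≈ sumE G R g
  sumE-cong f≈g = trans (sumE≈sum _) (trans (sum-cong-≋ f≈g) (sym (sumE≈sum _)))

  inner-congᵛ : ∀ w {v v′ : Fin m → ℤ} → (∀ e → v e ≡ v′ e) → inner G R w v ≈ inner G R w v′
  inner-congᵛ w v≡v′ = sumE-cong (λ e → reflexive (≡.cong (λ z → zm z (w e)) (v≡v′ e)))

  inner-congʷ : ∀ {w w′} v → (∀ e → w e ≈ w′ e) → inner G R w v ≈ inner G R w′ v
  inner-congʷ v w≈w′ = sumE-cong (λ e → zmul-cong (v e) (w≈w′ e))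

  inner-+ : ∀ w w′ v → inner G R (λ e → w e + w′ e) v ≈ inner G R w v + inner G R w′ v
  inner-+ w w′ v = begin
    inner G R (λ e → w e + w′ e) v
      ≈⟨ sumE≈sum _ ⟩
    sum (λ e → zm (v e) (w e + w′ e))
      ≈⟨ sum-cong-≋ (λ e → zmul-+ (v e) (w e) (w′ e)) ⟩
    sum (λ e → zm (v e) (w e) + zm (v e) (w′ e))
      ≈⟨ ∑-distrib-+ (λ e → zm (v e) (w e)) (λ e → zm (v e) (w′ e)) ⟩
    sum (λ e → zm (v e) (w e)) + sum (λ e → zm (v e) (w′ e))
      ≈⟨ sym (+-cong (sumE≈sum _) (sumE≈sum _)) ⟩
    inner G R w v + inner G R w′ v ∎

  ∫ : (Fin m → Carrier) → List (Dart G) → Carrier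
  ∫ w ds = foldr (λ d acc → zm (signD G d) (w (ed d)) + acc) 0# ds

  ∫-++ : ∀ w as bs → ∫ w (as ++ bs) ≈ ∫ w as + ∫ w bs
  ∫-++ w []       bs = sym (+-identityˡ _)
  ∫-++ w (d ∷ as) bs = trans (+-cong refl (∫-++ w as bs)) (sym (+-assoc _ _ _))

  inner-walk : ∀ w ds → inner G R w (cv ds) ≈ ∫ w ds
  inner-walk w []       = trans (sumE≈sum _) (sum-zero {m} (λ _ → refl))
  inner-walk w (d ∷ ds) = begin
    inner G R w (cv (d ∷ ds))                   ≈⟨ sumE≈sum _ ⟩
    sum (λ e → zm (cv (d ∷ ds) e) (w e))        ≈⟨ sum-cong-≋ split ⟩
    sum (λ e → atD e + zm (cv ds e) (w e))       ≈⟨ ∑-distrib-+ atD (λ e → zm (cv ds e) (w e)) ⟩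
    sum atD + sum (λ e → zm (cv ds e) (w e))     ≈⟨ +-cong (sum-single (ed d) offD) (sym (sumE≈sum _)) ⟩
    atD (ed d) + inner G R w (cv ds)             ≈⟨ +-cong onD (inner-walk w ds) ⟩
    zm (signD G d) (w (ed d)) + ∫ w ds           ∎
    where
    atD : Fin m → Carrier
    atD e = if does (ed d ≟ᶠ e) then zm (signD G d) (w e) else 0#
    split : ∀ e → zm (cv (d ∷ ds) e) (w e) ≈ atD e + zm (cv ds e) (w e)
    split e with ed d ≟ᶠ e
    ... | yes _ = zmul-sign d (cv ds e) (w e)
    ... | no  _ = sym (+-identityˡ _)
    offD : ∀ e → e ≢ ed d → atD e ≈ 0#
    offD e e≢ with ed d ≟ᶠ e
    ... | yes d≡e = ⊥-elim (e≢ (≡.sym d≡e))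
    ... | no  _   = refl
    onD : atD (ed d) ≈ zm (signD G d) (w (ed d))
    onD with ed d ≟ᶠ ed d
    ... | yes _    = refl
    ... | no d≢d = ⊥-elim (d≢d ≡.refl)

  gradient : (Fin n → Carrier) → Fin m → Carrier
  gradient φ e = φ (tgt e) - φ (src e)

  ∫-gradient : ∀ φ ds {x y} → Chain G x ds y → ∫ (gradient φ) ds ≈ φ y - φ x
  ∫-gradient φ []       ≡.refl = sym (-‿inverseʳ _)
  ∫-gradient φ (d ∷ ds) {x} {y} (≡.refl , c) = begin
    zm (signD G d) (gradient φ (ed d)) + ∫ (gradient φ) ds ≈⟨ +-cong (along d) (∫-gradient φ ds c) ⟩
    (φ (hd d) - φ (tl d)) + (φ y - φ (hd d))
      ≈⟨ solve 4 (λ a b c e → ((a ⊕ b) ⊕ (c ⊕ e)) ⊜ ((c ⊕ b) ⊕ (a ⊕ e))) refl _ _ _ _ ⟩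
    (φ y - φ (tl d)) + (φ (hd d) - φ (hd d))       ≈⟨ +-cong refl (-‿inverseʳ _) ⟩
    (φ y - φ (tl d)) + 0#                          ≈⟨ +-identityʳ _ ⟩
    φ y - φ (tl d)                                 ∎
    where
    along : ∀ d → zm (signD G d) (gradient φ (ed d)) ≈ φ (hd d) - φ (tl d)
    along (e , true)  = +-identityʳ _
    along (e , false) = trans (-‿cong (+-identityʳ _)) (trans (sym (-‿+-comm _ _))
                          (trans (+-cong refl (-‿involutive _)) (+-comm _ _)))

  inner-as-⟨⟩ : ∀ w v → inner G R w v ≈ sum (λ f → w f * zm (v f) 1#)
  inner-as-⟨⟩ w v = trans (sumE≈sum _) (sum-cong-≋ (λ f → zmul-* (v f) (w f)))

  reduced : EdgeSet m → (Fin m → Carrier) → (Fin m → ℤ) → Carrier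
  reduced S α v = sumE G R (λ e → if S e then 0# else zm (v e) (α e))

  reduced-congᵅ : ∀ S {α α′} v → (∀ e → S e ≡ false → α e ≈ α′ e) → reduced S α v ≈ reduced S α′ v
  reduced-congᵅ S v α≈α′ = sumE-cong λ e → helper e
    where
    helper : ∀ e → (if S e then 0# else zm (v e) _) ≈ (if S e then 0# else zm (v e) _)
    helper e with S e in Se
    ... | true  = refl
    ... | false = zmul-cong (v e) (α≈α′ e Se)

  reduced-congᵛ : ∀ S α {v v′} → (∀ e → v e ≡ v′ e) → reduced S α v ≈ reduced S α v′
  reduced-congᵛ S α v≡v′ = sumE-cong λ e →
    reflexive (≡.cong (λ z → if S e then 0# else zm z (α e)) (v≡v′ e))

-- Integrating w along tree walks from r gives a potential φ
-- whose gradient agrees with w on tree edges; hence α = w − ∇φ vanishes on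
-- S, and on every closed walk ⟨w, C⟩ = ⟨α, C⟩ only involves non-tree edges.
module TreeReduction (G : Graph) (R : RealField) {S : EdgeSet (Graph.m G)}
                     (spanning : IsSpanningTree G S) (r : Fin (Graph.n G))
                     (w : Fin (Graph.m G) → RealField.Carrier R) where
  open Graph G
  open RealField R
  open FieldFacts R
  open IntegerMultiples G R
  open Pairing G R
  open Walks G using (tl; hd; ed; cv; InS; closedWalk-null; reachWalk; chain-++)
  open import Relation.Binary.Reasoning.Setoid setoid

  treeWalk : ∀ x y → ∃[ ds ] (Chain G x ds y × All (InS S) ds)
  treeWalk x y = reachWalk (proj₁ spanning x y)

  ∫-treeLoop : ∀ {x} ds → Chain G x ds x → All (InS S) ds → ∫ w ds ≈ 0#
  ∫-treeLoop ds c al = trans (sym (inner-walk w ds))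
    (trans (inner-congᵛ w (closedWalk-null (proj₂ spanning) ds c al)) (trans (sumE≈sum _) (sum-zero {m} (λ _ → refl))))

  φ : Fin n → Carrier
  φ x = ∫ w (proj₁ (treeWalk r x))

  -- Around the loops  r → src e → tgt e → r  and  r → tgt e → r  (the
  -- first using e, the rest tree walks) w integrates to zero; subtracting
  -- gives φ (tgt e) − φ (src e) = w e.
  gradient-on-tree : ∀ e → T (S e) → gradient φ e ≈ w e
  gradient-on-tree e e∈S =
    let Ps , cPs , aPs = treeWalk r (src e)
        Pt , cPt , aPt = treeWalk r (tgt e)
        Q  , cQ  , aQ  = treeWalk (tgt e) r
        through-e : ∫ w Ps + (w e + ∫ w Q) ≈ 0#
        through-e = trans (+-cong refl (+-cong (sym (+-identityʳ (w e))) refl))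
                    (trans (sym (∫-++ w Ps ((e , true) ∷ Q)))
                           (∫-treeLoop _ (chain-++ Ps cPs (≡.refl , cQ)) (++⁺ aPs (e∈S ∷ aQ))))
        back : ∫ w Pt + ∫ w Q ≈ 0#
        back = trans (sym (∫-++ w Pt Q)) (∫-treeLoop _ (chain-++ Pt cPt cQ) (++⁺ aPt aQ))
    in difference-of-zeros through-e back

  α : Fin m → Carrier
  α e = w e - gradient φ e

  α-on-tree : ∀ e → T (S e) → α e ≈ 0#
  α-on-tree e e∈S = trans (+-cong refl (-‿cong (gradient-on-tree e e∈S))) (-‿inverseʳ (w e))

  closed-reduces : ∀ {x} ds → Chain G x ds x → inner G R w (cv ds) ≈ reduced S α (cv ds)
  closed-reduces ds c = begin
    inner G R w (cv ds)
      ≈⟨ inner-congʷ (cv ds) (λ e → sym ([x-y]+y≈x (w e) (gradient φ e))) ⟩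
    inner G R (λ e → α e + gradient φ e) (cv ds)
      ≈⟨ inner-+ α (gradient φ) (cv ds) ⟩
    inner G R α (cv ds) + inner G R (gradient φ) (cv ds)
      ≈⟨ +-cong refl (trans (inner-walk (gradient φ) ds) (trans (∫-gradient φ ds c) (-‿inverseʳ _))) ⟩
    inner G R α (cv ds) + 0#
      ≈⟨ +-identityʳ _ ⟩
    inner G R α (cv ds)
      ≈⟨ sumE-cong dropTree ⟩
    reduced S α (cv ds) ∎
    where
    dropTree : ∀ e → zm (cv ds e) (α e) ≈ (if S e then 0# else zm (cv ds e) (α e))
    dropTree e with S e in Se
    ... | true  = trans (zmul-cong (cv ds e) (α-on-tree e (≡.subst T (≡.sym Se) _))) (zmul-0 (cv ds e))
    ... | false = refl

  cycle-reduces : ∀ v → IsCycle G v → inner G R w v ≈ reduced S α v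
  cycle-reduces v (ds , (_ , (_ , c) , _) , cv≡v) =
    trans (inner-congᵛ w (λ e → ≡.sym (cv≡v e)))
          (trans (closed-reduces ds c) (reduced-congᵛ S α cv≡v))

module Equivalence (G : Graph) (R : RealField) (𝔠 : CycleOrientationConfig G) where
  open Graph G
  open RealField R
  open FieldFacts R
  open IntegerMultiples G R
  open Pairing G R
  open CycleOrientationConfig 𝔠
  open import Relation.Binary.Reasoning.Setoid setoid

  Weighable : EdgeSet m → Set
  Weighable S = ∃[ α ] GoodWeights G R 𝔠 S α

  noCycles : ¬ Fin n → ∀ v → ¬ IsCycle G v
  noCycles none v ([]      , (nonempty , _) , _) = nonempty ≡.refl
  noCycles none v ((d ∷ _) , _)                   = none (tailD G d)

  -- (i) ⇒ (iii): relative to any spanning tree, the weights w − ∇φ are good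
  geometric⇒weighable : Geometric G R 𝔠 → ∀ S → IsSpanningTree G S → Weighable S
  geometric⇒weighable (w , _ , positive) S spanning with vertexOrNone n
  ... | inj₂ none = (λ _ → 0#) , λ v cycle _ → ⊥-elim (noCycles none v cycle)
  ... | inj₁ r    = α , λ v cycle chosen-v → <-≈ (positive v cycle chosen-v) (cycle-reduces v cycle)
    where open TreeReduction G R spanning r w

  module Fundamental {S : EdgeSet m} (spanning : IsSpanningTree G S) where
    open Walks.FundamentalCycles G spanning public

    C : Fin m → Fin m → ℤ
    C e = cycleVec G (fundamental e)

    reduced-fundamental : ∀ α e → S e ≡ false → reduced S α (C e) ≈ α e
    reduced-fundamental α e Se = trans (sumE≈sum _) (trans (sum-single e off) at-e)
      where
      off : ∀ f → f ≢ e → (if S f then 0# else zm (C e f) (α f)) ≈ 0#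
      off f f≢e with S f in Sf
      ... | true  = refl
      ... | false rewrite fundamental-other e f Sf (λ e≡f → f≢e (≡.sym e≡f)) = refl
      at-e : (if S e then 0# else zm (C e e) (α e)) ≈ α e
      at-e rewrite Se | fundamental-self e Se = +-identityʳ (α e)

  -- (ii) ⇒ (i): choose w in the span of the fundamental cycles of the
  -- non-tree edges with ⟨w, C e⟩ = α e (a Gram system); then the reduced
  -- weights of w are α, so w is positive on every chosen cycle.
  weighable⇒geometric : ∀ S → IsSpanningTree G S → Weighable S → Geometric G R 𝔠
  weighable⇒geometric S spanning (α , good) with vertexOrNone n
  ... | inj₂ none = (λ _ → 0#) , ([] , [] , λ _ → refl) , λ v cycle _ → ⊥-elim (noCycles none v cycle)
  ... | inj₁ r    = w , w∈H₁ , positive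
    where
    open Fundamental spanning
    u : Fin m → Fin m → Carrier
    u e f = zm (C e f) 1#
    open GramSystems R u

    nonTree : List (Fin m)
    nonTree = filter (λ e → S e ≟ᵇ false) (allFin m)

    nonTree⁻ : ∀ {e} → e ∈ nonTree → S e ≡ false
    nonTree⁻ e∈ = proj₂ (∈-filter⁻ (λ e → S e ≟ᵇ false) {xs = allFin m} e∈)

    nonTree⁺ : ∀ {e} → S e ≡ false → e ∈ nonTree
    nonTree⁺ {e} Se = ∈-filter⁺ (λ e → S e ≟ᵇ false) (∈-allFin e) Se

    pivots : Pivots nonTree
    pivots = (λ e e∈ → trans (reflexive (≡.cong (λ z → zm z 1#) (fundamental-self e (nonTree⁻ e∈))))
                             (+-identityʳ 1#))
           , λ e e′ _ e′∈ e≢e′ → reflexive (≡.cong (λ z → zm z 1#) (fundamental-other e e′ (nonTree⁻ e′∈) e≢e′))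

    solution : ∃[ β ] (∀ e → e ∈ nonTree → ⟨ combination nonTree β , u e ⟩ ≈ α e)
    solution = gramSolvable nonTree (filter⁺ (λ e → S e ≟ᵇ false) (allFin⁺ m)) pivots α

    w : Fin m → Carrier
    w = combination nonTree (proj₁ solution)

    w∈H₁ : InH1 G R w
    w∈H₁ = map (λ e → proj₁ solution e , C e) nonTree
         , All.map⁺ (All.tabulate (λ {e} e∈ → fundamental e , fundamental-isCycle e (nonTree⁻ e∈) , λ _ → ≡.refl))
         , λ f → reflexive (≡.sym (foldr-map _ (λ e → proj₁ solution e , C e) 0# nonTree))

    open TreeReduction G R spanning r w renaming (α to αʷ)

    αʷ≈α : ∀ e → S e ≡ false → αʷ e ≈ α e
    αʷ≈α e Se = begin
      αʷ e                    ≈⟨ sym (reduced-fundamental αʷ e Se) ⟩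
      reduced S αʷ (C e)      ≈⟨ sym (closed-reduces (fundamental e) (fundamental-closed e)) ⟩
      inner G R w (C e)       ≈⟨ inner-as-⟨⟩ w (C e) ⟩
      ⟨ w , u e ⟩             ≈⟨ proj₂ solution e (nonTree⁺ Se) ⟩
      α e                     ∎

    positive : ∀ v → IsCycle G v → chosen v → 0# < inner G R w v
    positive v cycle chosen-v = <-≈ (good v cycle chosen-v)
      (sym (trans (cycle-reduces v cycle) (reduced-congᵅ S v αʷ≈α)))

theorem3p5 : (G : Graph) (R : RealField) (𝔠 : CycleOrientationConfig G) →
    let open Graph G
        open RealField R
        i   = Geometric G R 𝔠
        ii  = ∃[ S ] (IsSpanningTree G S × ∃[ α ] GoodWeights G R 𝔠 S α)
        iii = ∀ S → IsSpanningTree G S → ∃[ α ] GoodWeights G R 𝔠 S α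
    in (i → ii) × (ii → iii) × (iii → i)
theorem3p5 G R 𝔠 = i⇒ii , ii⇒iii , iii⇒i
  where
  open Equivalence G R 𝔠

  tree : ∃[ S ] IsSpanningTree G S
  tree = SpanningTrees.spanningTree G

  i⇒ii : Geometric G R 𝔠 → ∃[ S ] (IsSpanningTree G S × Weighable S)
  i⇒ii geometric = proj₁ tree , proj₂ tree , geometric⇒weighable geometric (proj₁ tree) (proj₂ tree)

  ii⇒iii : ∃[ S ] (IsSpanningTree G S × Weighable S) → ∀ S → IsSpanningTree G S → Weighable S
  ii⇒iii (S , spanning , weighable) = geometric⇒weighable (weighable⇒geometric S spanning weighable)

  iii⇒i : (∀ S → IsSpanningTree G S → Weighable S) → Geometric G R 𝔠
  iii⇒i weighable = weighable⇒geometric (proj₁ tree) (proj₂ tree) (weighable (proj₁ tree) (proj₂ tree))
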